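{- Let $n \geq 2$ be an even integer and let $m$ be the largest integer such that $n \geq 2^m$. Then for each $r = 1, 2, \dots, m$, the hypercube $Q_n$ can be decomposed into cycles of length $2^r n$.
   Context: $Q_n$ is the $n$-dimensional hypercube (vertices: binary $n$-tuples; edges: pairs differing in exactly one coordinate). A decomposition of a graph into $k$-cycles is a partition of its edge set into edge sets of cycles with exactly $k$ edges. -}

module Defs where

open import Data.Bool using (Bool; true; false; if_then_else_)
open import Data.Nat using (ℕ; zero; suc; _+_; _≤_)
open import Data.Vec using (Vec; []; _∷_)
open import Data.List using (List; []; _∷_; length; lookup)
open import Data.List.Relation.Unary.All using (All)
open import Data.List.Relation.Unary.Any using (Any)
open import Data.List.Relation.Unary.Unique.Propositional using (Unique)
open import Data.Fin using (Fin)
open import Data.Product using (Σ; _×_; _,_)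
open import Data.Sum using (_⊎_)
open import Relation.Binary.PropositionalEquality using (_≡_)
open import Relation.Nullary using (yes; no)
open import Data.Bool.Properties using () renaming (_≟_ to _≟ᵇ_)

Vertex : ℕ → Set
Vertex n = Vec Bool n

hamming : ∀ {n} → Vertex n → Vertex n → ℕ
hamming [] [] = 0
hamming (a ∷ u) (b ∷ v) with a ≟ᵇ b
... | yes _ = hamming u v
... | no _  = suc (hamming u v)

Adj : ∀ {n} → Vertex n → Vertex n → Set
Adj u v = hamming u v ≡ 1

-- Consecutive pairs of a closed walk v0 v1 ... v(k-1) (v0):
-- (v0,v1), (v1,v2), ..., (v(k-1),v0).
closingPairs : ∀ {A : Set} → List A → List (A × A)
closingPairs [] = []
closingPairs {A} (x ∷ xs) = go x xs
  where
  go : A → List A → List (A × A)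
  go y [] = (y , x) ∷ []
  go y (z ∷ zs) = (y , z) ∷ go z zs

record Cycle (n k : ℕ) : Set where
  field
    verts    : List (Vertex n)
    len      : length verts ≡ k
    atLeast3 : 3 ≤ k
    distinct : Unique verts
    adjacent : All (λ p → Adj (Data.Product.proj₁ p) (Data.Product.proj₂ p)) (closingPairs verts)
open Cycle public

EdgeOf : ∀ {n k} → Vertex n → Vertex n → Cycle n k → Set
EdgeOf u v C = Any (λ p → (Data.Product.proj₁ p ≡ u × Data.Product.proj₂ p ≡ v)
                         ⊎ (Data.Product.proj₁ p ≡ v × Data.Product.proj₂ p ≡ u))
                   (closingPairs (verts C))

Decomposition : ℕ → ℕ → Set
Decomposition n k =
  Σ (List (Cycle n k)) λ cs →
    ∀ (u v : Vertex n) → Adj u v →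
      Σ (Fin (length cs)) λ j →
        EdgeOf u v (lookup cs j) ×
        (∀ (j′ : Fin (length cs)) → EdgeOf u v (lookup cs j′) → j′ ≡ j)

-- Pairing coordinates and reading each pair along the Gray code 00, 10, 11, 01 identifies Q_{2t}
-- with the torus ℤ₄ᵗ, whose edges are the pairs {w , w + e_c}.  The cycles are staircase walks:
-- they proceed in blocks of t moves, coordinate c moving by ±1 at the c-th move of every block,
-- and they are built from a single 4-cycle on one coordinate by adding coordinates one at a time.
-- A new coordinate either multiplies the number of cycles by 4 (one per offset in ℤ₄) and keeps the
-- period, or multiplies it by 2 and doubles the period: it then moves backwards once per old
-- period P, so it drifts by P − 2 ≡ 2 between the two halves of the new period, and this drift
-- together with the two offsets 0, 1 covers ℤ₄.  By induction on the coordinates, for every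
-- direction c the map (cycle, block) ↦ c-edge traversed is a bijection onto the c-edges of the
-- torus, so each edge lies on exactly one cycle.  With r − 1 doubling coordinates among the t − 1
-- added ones (room for them is what 2^r ≤ n = 2t gives) the period is 2^(r+1), and every cycle
-- has length 2^(r+1) t = 2^r n.
module Submission where

open import Algebra.Bundles using (AbelianGroup)
import Algebra.Properties.AbelianGroup as AbelianGroupProperties
import Algebra.Properties.CommutativeSemigroup as CommutativeSemigroupProperties
open import Data.Bool using (Bool; true; false; if_then_else_)
open import Data.Bool.Properties using (if-float; if-eta)
open import Data.Empty using (⊥-elim)
open import Data.Fin using (Fin; zero; suc; toℕ; fromℕ<; cast; remQuot; combine)
open import Data.Fin.Properties
  using (cast-involutive; toℕ-injective; toℕ<n; toℕ-fromℕ<; remQuot-combine; combine-remQuot)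
open import Data.List using (List; []; _∷_; _++_; length; lookup; tabulate; drop; applyUpTo; replicate)
open import Data.List.Properties
  using (length-applyUpTo; length-tabulate; lookup-tabulate; length-++; length-replicate)
open import Data.List.Relation.Unary.All using (All)
import Data.List.Relation.Unary.All.Properties as All
open import Data.List.Relation.Unary.Any using (Any)
import Data.List.Relation.Unary.Any.Properties as Any
import Data.List.Relation.Unary.Unique.Propositional.Properties as Unique
open import Data.Nat
  using (ℕ; zero; suc; _+_; _*_; _^_; _∸_; _≤_; _<_; z≤n; s≤s; s≤s⁻¹; NonZero; pred; >-nonZero⁻¹)
open import Data.Nat.DivMod
  using (_%_; _/_; [m+n]%n≡m%n; [m+kn]%n≡m%n; m<n⇒m%n≡m; m<n⇒m/n≡0; m*n/n≡m; +-distrib-/-∣ʳ; m%n<n;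
         m≡m%n+[m/n]*n; m<n*o⇒m/o<n)
open import Data.Nat.Divisibility using (_∣_; divides; n∣m*n)
open import Data.Nat.Properties
  using (suc-injective; ≤-refl; ≤-trans; <⇒≤; ≤-reflexive; <-trans; <⇒≢; _<?_; ≮⇒≥; suc-pred; pred-mono-≤;
         +-assoc; m≤m+n; m∸n+n≡m; +-cancelʳ-<; +-monoˡ-<; +-mono-≤; m≤n⇒m<n∨m≡n;
         *-comm; *-monoˡ-≤; m≤m*n; *-cancelʳ-≤; ^-monoʳ-≤)
open import Data.Nat.Tactic.RingSolver using (solve-∀)
open import Data.Product using (Σ; ∃-syntax; _×_; _,_; proj₁; proj₂; uncurry)
open import Data.Sum using (_⊎_; inj₁; inj₂)
open import Data.Vec using (Vec; []; _∷_; _[_]%=_)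
open import Data.Vec.Properties using (∷-injectiveˡ; ∷-injectiveʳ)
open import Function using (_∘_)
open import Level using (0ℓ)
open import Relation.Binary.PropositionalEquality
open import Relation.Binary.PropositionalEquality.Algebra using (isMagma)
open import Relation.Nullary using (yes; no)

open import Defs

data ℤ₄ : Set where
  z0 z1 z2 z3 : ℤ₄

suc₄ : ℤ₄ → ℤ₄
suc₄ z0 = z1
suc₄ z1 = z2
suc₄ z2 = z3
suc₄ z3 = z0

infixl 6 _⊕_
_⊕_ : ℤ₄ → ℤ₄ → ℤ₄
z0 ⊕ y = y
z1 ⊕ y = suc₄ y
z2 ⊕ y = suc₄ (suc₄ y)
z3 ⊕ y = suc₄ (suc₄ (suc₄ y))

infix 8 -_
-_ : ℤ₄ → ℤ₄
- z0 = z0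
- z1 = z3
- z2 = z2
- z3 = z1

suc₄-⊕ : ∀ x y → suc₄ (x ⊕ y) ≡ suc₄ x ⊕ y
suc₄-⊕ z0 y = refl
suc₄-⊕ z1 y = refl
suc₄-⊕ z2 y = refl
suc₄-⊕ z3 z0 = refl
suc₄-⊕ z3 z1 = refl
suc₄-⊕ z3 z2 = refl
suc₄-⊕ z3 z3 = refl

⊕-assoc : ∀ x y z → (x ⊕ y) ⊕ z ≡ x ⊕ (y ⊕ z)
⊕-assoc z0 y z = refl
⊕-assoc z1 y z = sym (suc₄-⊕ y z)
⊕-assoc z2 y z = trans (sym (suc₄-⊕ (suc₄ y) z)) (cong suc₄ (sym (suc₄-⊕ y z)))
⊕-assoc z3 y z = trans (sym (suc₄-⊕ (suc₄ (suc₄ y)) z)) (cong suc₄ (⊕-assoc z2 y z))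

⊕-identityʳ : ∀ x → x ⊕ z0 ≡ x
⊕-identityʳ z0 = refl
⊕-identityʳ z1 = refl
⊕-identityʳ z2 = refl
⊕-identityʳ z3 = refl

⊕-comm : ∀ x y → x ⊕ y ≡ y ⊕ x
⊕-comm z0 y = sym (⊕-identityʳ y)
⊕-comm x z0 = ⊕-identityʳ x
⊕-comm z1 z1 = refl
⊕-comm z1 z2 = refl
⊕-comm z1 z3 = refl
⊕-comm z2 z1 = refl
⊕-comm z2 z2 = refl
⊕-comm z2 z3 = refl
⊕-comm z3 z1 = refl
⊕-comm z3 z2 = refl
⊕-comm z3 z3 = refl

⊕-inverseˡ : ∀ x → - x ⊕ x ≡ z0
⊕-inverseˡ z0 = refl
⊕-inverseˡ z1 = refl
⊕-inverseˡ z2 = refl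
⊕-inverseˡ z3 = refl

ℤ₄-abelianGroup : AbelianGroup 0ℓ 0ℓ
ℤ₄-abelianGroup = record
  { _≈_ = _≡_
  ; _∙_ = _⊕_
  ; ε = z0
  ; _⁻¹ = -_
  ; isAbelianGroup = record
    { isGroup = record
      { isMonoid = record
        { isSemigroup = record { isMagma = isMagma _⊕_ ; assoc = ⊕-assoc }
        ; identity = (λ _ → refl) , ⊕-identityʳ
        }
      ; inverse = ⊕-inverseˡ , λ x → trans (⊕-comm x (- x)) (⊕-inverseˡ x)
      ; ⁻¹-cong = cong -_
      }
    ; comm = ⊕-comm
    }
  }

open AbelianGroupProperties ℤ₄-abelianGroup
  using (identityʳ-unique)
  renaming (∙-cancelˡ to ⊕-cancelˡ; ∙-cancelʳ to ⊕-cancelʳ; \\-leftDividesˡ to ⊕-[-⊕])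
open CommutativeSemigroupProperties (AbelianGroup.commutativeSemigroup ℤ₄-abelianGroup)
  using () renaming (xy∙z≈xz∙y to xy⊕z≡xz⊕y)

IsUnit : ℤ₄ → Set
IsUnit s = s ≡ z1 ⊎ s ≡ z3

IsEven : ℤ₄ → Set
IsEven e = e ≡ z0 ⊎ e ≡ z2

unit≢z0 : ∀ {s} → IsUnit s → s ≢ z0
unit≢z0 (inj₁ refl) ()
unit≢z0 (inj₂ refl) ()

unit-moves : ∀ {s} → IsUnit s → ∀ a → a ⊕ s ≢ a
unit-moves u a = unit≢z0 u ∘ identityʳ-unique a _

even≢unit⊕even : ∀ {s e e'} → IsUnit s → IsEven e → IsEven e' → e ≢ s ⊕ e'
even≢unit⊕even (inj₁ refl) (inj₁ refl) (inj₁ refl) ()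
even≢unit⊕even (inj₁ refl) (inj₁ refl) (inj₂ refl) ()
even≢unit⊕even (inj₁ refl) (inj₂ refl) (inj₁ refl) ()
even≢unit⊕even (inj₁ refl) (inj₂ refl) (inj₂ refl) ()
even≢unit⊕even (inj₂ refl) (inj₁ refl) (inj₁ refl) ()
even≢unit⊕even (inj₂ refl) (inj₁ refl) (inj₂ refl) ()
even≢unit⊕even (inj₂ refl) (inj₂ refl) (inj₁ refl) ()
even≢unit⊕even (inj₂ refl) (inj₂ refl) (inj₂ refl) ()

toℤ₄ : ℕ → ℤ₄
toℤ₄ zero = z0
toℤ₄ (suc n) = suc₄ (toℤ₄ n)

toℤ₄-+ : ∀ m n → toℤ₄ (m + n) ≡ toℤ₄ m ⊕ toℤ₄ n
toℤ₄-+ zero n = refl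
toℤ₄-+ (suc m) n = trans (cong suc₄ (toℤ₄-+ m n)) (suc₄-⊕ (toℤ₄ m) (toℤ₄ n))

toℤ₄-suc : ∀ n → toℤ₄ (suc n) ≡ toℤ₄ n ⊕ z1
toℤ₄-suc n = ⊕-comm z1 (toℤ₄ n)

toℕ₄ : ℤ₄ → ℕ
toℕ₄ z0 = 0
toℕ₄ z1 = 1
toℕ₄ z2 = 2
toℕ₄ z3 = 3

toℕ₄<4 : ∀ x → toℕ₄ x < 4
toℕ₄<4 z0 = s≤s z≤n
toℕ₄<4 z1 = s≤s (s≤s z≤n)
toℕ₄<4 z2 = s≤s (s≤s (s≤s z≤n))
toℕ₄<4 z3 = s≤s (s≤s (s≤s (s≤s z≤n)))

toℤ₄-toℕ₄ : ∀ x → toℤ₄ (toℕ₄ x) ≡ x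
toℤ₄-toℕ₄ z0 = refl
toℤ₄-toℕ₄ z1 = refl
toℤ₄-toℕ₄ z2 = refl
toℤ₄-toℕ₄ z3 = refl

toℕ₄-toℤ₄ : ∀ {n} → n < 4 → toℕ₄ (toℤ₄ n) ≡ n
toℕ₄-toℤ₄ {0} _ = refl
toℕ₄-toℤ₄ {1} _ = refl
toℕ₄-toℤ₄ {2} _ = refl
toℕ₄-toℤ₄ {3} _ = refl
toℕ₄-toℤ₄ {suc (suc (suc (suc _)))} (s≤s (s≤s (s≤s (s≤s ()))))

toℤ₄-injective-<4 : ∀ {m n} → m < 4 → n < 4 → toℤ₄ m ≡ toℤ₄ n → m ≡ n
toℤ₄-injective-<4 m<4 n<4 e = trans (sym (toℕ₄-toℤ₄ m<4)) (trans (cong toℕ₄ e) (toℕ₄-toℤ₄ n<4))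

gray₁ gray₂ : ℤ₄ → Bool
gray₁ z0 = false
gray₁ z1 = true
gray₁ z2 = true
gray₁ z3 = false
gray₂ z0 = false
gray₂ z1 = false
gray₂ z2 = true
gray₂ z3 = true

infixr 5 _∷ᵍ_
_∷ᵍ_ : ∀ {n} → ℤ₄ → Vertex n → Vertex (2 + n)
x ∷ᵍ u = gray₁ x ∷ gray₂ x ∷ u

gray : ∀ {t} → Vec ℤ₄ t → Vertex (t * 2)
gray [] = []
gray (x ∷ xs) = x ∷ᵍ gray xs

ungray : ∀ t → Vertex (t * 2) → Vec ℤ₄ t
ungray zero [] = []
ungray (suc t) (false ∷ false ∷ u) = z0 ∷ ungray t u
ungray (suc t) (true ∷ false ∷ u) = z1 ∷ ungray t u
ungray (suc t) (true ∷ true ∷ u) = z2 ∷ ungray t u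
ungray (suc t) (false ∷ true ∷ u) = z3 ∷ ungray t u

gray-ungray : ∀ t (u : Vertex (t * 2)) → gray (ungray t u) ≡ u
gray-ungray zero [] = refl
gray-ungray (suc t) (false ∷ false ∷ u) = cong (z0 ∷ᵍ_) (gray-ungray t u)
gray-ungray (suc t) (true ∷ false ∷ u) = cong (z1 ∷ᵍ_) (gray-ungray t u)
gray-ungray (suc t) (true ∷ true ∷ u) = cong (z2 ∷ᵍ_) (gray-ungray t u)
gray-ungray (suc t) (false ∷ true ∷ u) = cong (z3 ∷ᵍ_) (gray-ungray t u)

ungray-gray : ∀ {t} (x : Vec ℤ₄ t) → ungray t (gray x) ≡ x
ungray-gray [] = refl
ungray-gray (z0 ∷ xs) = cong (z0 ∷_) (ungray-gray xs)
ungray-gray (z1 ∷ xs) = cong (z1 ∷_) (ungray-gray xs)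
ungray-gray (z2 ∷ xs) = cong (z2 ∷_) (ungray-gray xs)
ungray-gray (z3 ∷ xs) = cong (z3 ∷_) (ungray-gray xs)

gray-injective : ∀ {t} {x y : Vec ℤ₄ t} → gray x ≡ gray y → x ≡ y
gray-injective {t} {x} {y} e =
  trans (sym (ungray-gray x)) (trans (cong (ungray t) e) (ungray-gray y))

hamming-refl : ∀ {n} (u : Vertex n) → hamming u u ≡ 0
hamming-refl [] = refl
hamming-refl (false ∷ u) = hamming-refl u
hamming-refl (true ∷ u) = hamming-refl u

hamming-∷ : ∀ {n} a (u v : Vertex n) → hamming (a ∷ u) (a ∷ v) ≡ hamming u v
hamming-∷ false u v = refl
hamming-∷ true u v = refl

hamming≡0⇒≡ : ∀ {n} {u v : Vertex n} → hamming u v ≡ 0 → u ≡ v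
hamming≡0⇒≡ {u = []} {[]} e = refl
hamming≡0⇒≡ {u = false ∷ u} {false ∷ v} e = cong (false ∷_) (hamming≡0⇒≡ e)
hamming≡0⇒≡ {u = true ∷ u} {true ∷ v} e = cong (true ∷_) (hamming≡0⇒≡ e)
hamming≡0⇒≡ {u = false ∷ u} {true ∷ v} ()
hamming≡0⇒≡ {u = true ∷ u} {false ∷ v} ()

suc-hamming≡1⇒≡ : ∀ {n} {u v : Vertex n} → suc (hamming u v) ≡ 1 → u ≡ v
suc-hamming≡1⇒≡ = hamming≡0⇒≡ ∘ suc-injective

Joins : ∀ {A : Set} → A → A → A × A → Set
Joins u v p = (proj₁ p ≡ u × proj₂ p ≡ v) ⊎ (proj₁ p ≡ v × proj₂ p ≡ u)

Joins-map : ∀ {A B : Set} (f : A → B) {u v a b : A} → Joins u v (a , b) → Joins (f u) (f v) (f a , f b)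
Joins-map f (inj₁ (e₁ , e₂)) = inj₁ (cong f e₁ , cong f e₂)
Joins-map f (inj₂ (e₁ , e₂)) = inj₂ (cong f e₁ , cong f e₂)

step : ∀ {t} → Fin t → ℤ₄ → Vec ℤ₄ t → Vec ℤ₄ t
step c s x = x [ c ]%= (_⊕ s)

gray-step-adjacent : ∀ {t s} (c : Fin t) (x : Vec ℤ₄ t) → IsUnit s → Adj (gray x) (gray (step c s x))
gray-step-adjacent zero (x ∷ xs) u = trans (head-moves x u) (cong suc (hamming-refl (gray xs)))
  where
  head-moves : ∀ {n s} x {w : Vertex n} → IsUnit s →
               hamming (x ∷ᵍ w) ((x ⊕ s) ∷ᵍ w) ≡ suc (hamming w w)
  head-moves z0 (inj₁ refl) = refl
  head-moves z1 (inj₁ refl) = refl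
  head-moves z2 (inj₁ refl) = refl
  head-moves z3 (inj₁ refl) = refl
  head-moves z0 (inj₂ refl) = refl
  head-moves z1 (inj₂ refl) = refl
  head-moves z2 (inj₂ refl) = refl
  head-moves z3 (inj₂ refl) = refl
gray-step-adjacent (suc c) (x ∷ xs) u =
  trans (hamming-∷ (gray₁ x) _ _) (trans (hamming-∷ (gray₂ x) _ _) (gray-step-adjacent c xs u))

Joins-∘ : ∀ {A : Set} {u v p q x y : A} → Joins u v (p , q) → Joins p q (x , y) → Joins u v (x , y)
Joins-∘ (inj₁ (refl , refl)) j = j
Joins-∘ (inj₂ (refl , refl)) (inj₁ e) = inj₂ e
Joins-∘ (inj₂ (refl , refl)) (inj₂ e) = inj₁ e

Joins-sym : ∀ {A : Set} {u v p q : A} → Joins u v (p , q) → Joins p q (u , v)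
Joins-sym (inj₁ (refl , refl)) = inj₁ (refl , refl)
Joins-sym (inj₂ (refl , refl)) = inj₂ (refl , refl)

Joins-gray⁻ : ∀ {t} {a b x y : Vec ℤ₄ t} → Joins (gray a) (gray b) (gray x , gray y) → Joins a b (x , y)
Joins-gray⁻ (inj₁ (e₁ , e₂)) = inj₁ (gray-injective e₁ , gray-injective e₂)
Joins-gray⁻ (inj₂ (e₁ , e₂)) = inj₂ (gray-injective e₁ , gray-injective e₂)

step-inverse : ∀ {t} (c : Fin t) x → step c z1 (step c z3 x) ≡ x
step-inverse zero (x ∷ xs) = cong (_∷ xs) (trans (⊕-assoc x z3 z1) (⊕-identityʳ x))
step-inverse (suc c) (x ∷ xs) = cong (x ∷_) (step-inverse c xs)

step≡step⇒ : ∀ {t} (c' c : Fin t) {s} w → IsUnit s → step c' s w ≡ step c z1 w → c' ≡ c × s ≡ z1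
step≡step⇒ zero zero {s} (x ∷ w) u e = refl , ⊕-cancelˡ x s z1 (∷-injectiveˡ e)
step≡step⇒ zero (suc c) (x ∷ w) u e = ⊥-elim (unit-moves u x (∷-injectiveˡ e))
step≡step⇒ (suc c') zero (x ∷ w) u e = ⊥-elim (unit-moves (inj₁ refl) x (sym (∷-injectiveˡ e)))
step≡step⇒ (suc c') (suc c) (x ∷ w) u e with step≡step⇒ c' c w u (∷-injectiveʳ e)
... | refl , s≡z1 = refl , s≡z1

step-step≡⇒ : ∀ {t} (c' c : Fin t) {s} w → IsUnit s → step c' s (step c z1 w) ≡ w → c' ≡ c × s ≡ z3
step-step≡⇒ zero zero {s} (x ∷ w) u e =
  refl , z1⊕s≡z0⇒s≡z3 u (identityʳ-unique x (z1 ⊕ s) (trans (sym (⊕-assoc x z1 s)) (∷-injectiveˡ e)))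
  where
  z1⊕s≡z0⇒s≡z3 : ∀ {s} → IsUnit s → z1 ⊕ s ≡ z0 → s ≡ z3
  z1⊕s≡z0⇒s≡z3 (inj₁ refl) ()
  z1⊕s≡z0⇒s≡z3 (inj₂ refl) _ = refl
step-step≡⇒ zero (suc c) (x ∷ w) u e = ⊥-elim (unit-moves u x (∷-injectiveˡ e))
step-step≡⇒ (suc c') zero (x ∷ w) u e = ⊥-elim (unit-moves (inj₁ refl) x (∷-injectiveˡ e))
step-step≡⇒ (suc c') (suc c) (x ∷ w) u e with step-step≡⇒ c' c w u (∷-injectiveʳ e)
... | refl , s≡z3 = refl , s≡z3

forward : ℤ₄ → Bool
forward z3 = false
forward _ = true

-- For a move a → b = a + s with s = ±1, the endpoint w with {a , b} = {w , w + 1}.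
lowerEnd : ∀ {A : Set} → ℤ₄ → A → A → A
lowerEnd s a b = if forward s then a else b

lowerEnd-∷ : ∀ {A : Set} {n} s (a b : A) (xs ys : Vec A n) →
             lowerEnd s (a ∷ xs) (b ∷ ys) ≡ lowerEnd s a b ∷ lowerEnd s xs ys
lowerEnd-∷ s a b xs ys with forward s
... | true = refl
... | false = refl

move-on-edge : ∀ {t} {c c' : Fin t} {s w x} → IsUnit s → Joins w (step c z1 w) (x , step c' s x) →
               c' ≡ c × lowerEnd s x (step c' s x) ≡ w
move-on-edge u (inj₁ (refl , e)) with step≡step⇒ _ _ _ u e
... | refl , refl = refl , refl
move-on-edge u (inj₂ (refl , e)) with step-step≡⇒ _ _ _ u e
... | refl , refl = refl , e

TorusEdge : ∀ {t} → Vertex (t * 2) → Vertex (t * 2) → Fin t → Vec ℤ₄ t → Set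
TorusEdge u v c w = Joins u v (gray w , gray (step c z1 w))

TorusEdgeOf : ∀ t → Vertex (t * 2) → Vertex (t * 2) → Set
TorusEdgeOf t u v = Σ (Fin t) λ c → Σ (Vec ℤ₄ t) λ w → TorusEdge u v c w

torusEdge-swap : ∀ {t} {u v : Vertex (t * 2)} → TorusEdgeOf t u v → TorusEdgeOf t v u
torusEdge-swap (c , w , inj₁ e) = c , w , inj₂ e
torusEdge-swap (c , w , inj₂ e) = c , w , inj₁ e

torusEdge-∷ : ∀ {t} x {u v : Vertex (t * 2)} → TorusEdgeOf t u v → TorusEdgeOf (suc t) (x ∷ᵍ u) (x ∷ᵍ v)
torusEdge-∷ x (c , w , e) = suc c , x ∷ w , Joins-map (x ∷ᵍ_) e

torusEdge-head : ∀ {t} x {u v : Vertex (t * 2)} → u ≡ v → TorusEdgeOf (suc t) (x ∷ᵍ u) ((x ⊕ z1) ∷ᵍ v)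
torusEdge-head {t} x {u} refl =
  zero , x ∷ ungray t u , inj₁ (cong (x ∷ᵍ_) (gray-ungray t u) , cong ((x ⊕ z1) ∷ᵍ_) (gray-ungray t u))

torusEdge-head⁻ : ∀ {t} x {u v : Vertex (t * 2)} → u ≡ v → TorusEdgeOf (suc t) ((x ⊕ z1) ∷ᵍ u) (x ∷ᵍ v)
torusEdge-head⁻ x u≡v = torusEdge-swap (torusEdge-head x (sym u≡v))

adjacent⇒torusEdge : ∀ t {u v : Vertex (t * 2)} → Adj u v → TorusEdgeOf t u v
adjacent⇒torusEdge zero {[]} {[]} ()
adjacent⇒torusEdge (suc t) {false ∷ false ∷ u} {false ∷ false ∷ v} h = torusEdge-∷ z0 (adjacent⇒torusEdge t h)
adjacent⇒torusEdge (suc t) {true ∷ false ∷ u} {true ∷ false ∷ v} h = torusEdge-∷ z1 (adjacent⇒torusEdge t h)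
adjacent⇒torusEdge (suc t) {true ∷ true ∷ u} {true ∷ true ∷ v} h = torusEdge-∷ z2 (adjacent⇒torusEdge t h)
adjacent⇒torusEdge (suc t) {false ∷ true ∷ u} {false ∷ true ∷ v} h = torusEdge-∷ z3 (adjacent⇒torusEdge t h)
adjacent⇒torusEdge (suc t) {false ∷ false ∷ u} {true ∷ false ∷ v} h = torusEdge-head z0 (suc-hamming≡1⇒≡ h)
adjacent⇒torusEdge (suc t) {true ∷ false ∷ u} {true ∷ true ∷ v} h = torusEdge-head z1 (suc-hamming≡1⇒≡ h)
adjacent⇒torusEdge (suc t) {true ∷ true ∷ u} {false ∷ true ∷ v} h = torusEdge-head z2 (suc-hamming≡1⇒≡ h)
adjacent⇒torusEdge (suc t) {false ∷ true ∷ u} {false ∷ false ∷ v} h = torusEdge-head z3 (suc-hamming≡1⇒≡ h)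
adjacent⇒torusEdge (suc t) {true ∷ false ∷ u} {false ∷ false ∷ v} h = torusEdge-head⁻ z0 (suc-hamming≡1⇒≡ h)
adjacent⇒torusEdge (suc t) {true ∷ true ∷ u} {true ∷ false ∷ v} h = torusEdge-head⁻ z1 (suc-hamming≡1⇒≡ h)
adjacent⇒torusEdge (suc t) {false ∷ true ∷ u} {true ∷ true ∷ v} h = torusEdge-head⁻ z2 (suc-hamming≡1⇒≡ h)
adjacent⇒torusEdge (suc t) {false ∷ false ∷ u} {false ∷ true ∷ v} h = torusEdge-head⁻ z3 (suc-hamming≡1⇒≡ h)
adjacent⇒torusEdge (suc t) {false ∷ false ∷ u} {true ∷ true ∷ v} ()
adjacent⇒torusEdge (suc t) {true ∷ true ∷ u} {false ∷ false ∷ v} ()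
adjacent⇒torusEdge (suc t) {false ∷ true ∷ u} {true ∷ false ∷ v} ()
adjacent⇒torusEdge (suc t) {true ∷ false ∷ u} {false ∷ true ∷ v} ()

module _ {A : Set} where

  pathPairs : A → A → List A → List (A × A)
  pathPairs x y [] = (y , x) ∷ []
  pathPairs x y (z ∷ zs) = (y , z) ∷ pathPairs x z zs

  closingPairs-∷∷ : ∀ x y zs → closingPairs (x ∷ y ∷ zs) ≡ (x , y) ∷ pathPairs x y zs
  closingPairs-∷∷ x y [] = refl
  closingPairs-∷∷ x y (z ∷ zs) = cong (λ ps → (x , y) ∷ (y , z) ∷ drop 1 ps) (closingPairs-∷∷ x z zs)

  closingPairs≡pathPairs : ∀ x zs → closingPairs (x ∷ zs) ≡ pathPairs x x zs
  closingPairs≡pathPairs x [] = refl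
  closingPairs≡pathPairs x (z ∷ zs) = closingPairs-∷∷ x z zs

  pathPairs-applyUpTo : ∀ x (f : ℕ → A) m → f (suc m) ≡ x →
    pathPairs x (f 0) (applyUpTo (f ∘ suc) m) ≡ applyUpTo (λ p → f p , f (suc p)) (suc m)
  pathPairs-applyUpTo x f zero e = cong (λ y → (f 0 , y) ∷ []) (sym e)
  pathPairs-applyUpTo x f (suc m) e = cong ((f 0 , f 1) ∷_) (pathPairs-applyUpTo x (f ∘ suc) m e)

  closingPairs-applyUpTo : ∀ (f : ℕ → A) {L} → 0 < L → f L ≡ f 0 →
    closingPairs (applyUpTo f L) ≡ applyUpTo (λ p → f p , f (suc p)) L
  closingPairs-applyUpTo f {suc m} _ e =
    trans (closingPairs≡pathPairs (f 0) _) (pathPairs-applyUpTo (f 0) f m e)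

module _ {n L : ℕ} (f : ℕ → Vertex n) (3≤L : 3 ≤ L) (closes : f L ≡ f 0) where

  private
    pairs : closingPairs (applyUpTo f L) ≡ applyUpTo (λ p → f p , f (suc p)) L
    pairs = closingPairs-applyUpTo f (≤-trans (s≤s z≤n) 3≤L) closes

  closedWalk : (∀ {p p'} → p < p' → p' < L → f p ≢ f p') → (∀ p → Adj (f p) (f (suc p))) → Cycle n L
  closedWalk injective adj = record
    { verts = applyUpTo f L
    ; len = length-applyUpTo f L
    ; atLeast3 = 3≤L
    ; distinct = Unique.applyUpTo⁺₁ f L injective
    ; adjacent = subst (All _) (sym pairs) (All.applyUpTo⁺₂ _ L adj)
    }

  edge-closedWalk⁻ : ∀ {u v} → Any (Joins u v) (closingPairs (applyUpTo f L)) →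
                     ∃[ p ] p < L × Joins u v (f p , f (suc p))
  edge-closedWalk⁻ e = Any.applyUpTo⁻ _ (subst (Any _) pairs e)

  edge-closedWalk⁺ : ∀ {u v p} → p < L → Joins u v (f p , f (suc p)) →
                     Any (Joins u v) (closingPairs (applyUpTo f L))
  edge-closedWalk⁺ p<L j = subst (Any _) (sym pairs) (Any.applyUpTo⁺ _ j p<L)

decomposition : ∀ {n k N} (C : Fin N → Cycle n k) →
  (∀ u v → Adj u v → Σ (Fin N) λ i → EdgeOf u v (C i) × (∀ i' → EdgeOf u v (C i') → i' ≡ i)) →
  Decomposition n k
decomposition {N = N} C unique = tabulate C , edge
  where
  N≡ : length (tabulate C) ≡ N
  N≡ = length-tabulate C

  lookup-tabulate-cast : ∀ j → lookup (tabulate C) j ≡ C (cast N≡ j)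
  lookup-tabulate-cast j =
    trans (cong (lookup (tabulate C)) (sym (cast-involutive (sym N≡) N≡ j))) (lookup-tabulate C (cast N≡ j))

  edge : ∀ u v → Adj u v → Σ (Fin (length (tabulate C))) λ j →
         EdgeOf u v (lookup (tabulate C) j) × (∀ j' → EdgeOf u v (lookup (tabulate C) j') → j' ≡ j)
  edge u v a with unique u v a
  ... | i , e , only =
    cast (sym N≡) i ,
    subst (EdgeOf u v) (sym (lookup-tabulate C i)) e ,
    λ j e' → trans (sym (cast-involutive (sym N≡) N≡ j))
                   (cong (cast (sym N≡)) (only (cast N≡ j) (subst (EdgeOf u v) (lookup-tabulate-cast j) e')))

data Kind : Set where
  keep double : Kind

radix : Kind → ℕ
radix keep = 4
radix double = 2

offset : Kind → ℤ₄
offset keep = z0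
offset double = z2

turnAt : ℕ → ℤ₄
turnAt zero = z3
turnAt (suc _) = z1

turn : Kind → (P : ℕ) → .{{NonZero P}} → ℕ → ℤ₄
turn keep P j = z1
turn double P j = turnAt (j % P)

trajectory : Kind → (P : ℕ) → .{{NonZero P}} → ℕ → ℤ₄
trajectory k P zero = z0
trajectory k P (suc j) = trajectory k P j ⊕ turn k P j

module _ (P : ℕ) .{{_ : NonZero P}} where

  turn-unit : ∀ k j → IsUnit (turn k P j)
  turn-unit keep j = inj₁ refl
  turn-unit double j with j % P
  ... | zero = inj₂ refl
  ... | suc _ = inj₁ refl

  turn-periodic : ∀ k j → turn k P (j + P) ≡ turn k P j
  turn-periodic keep j = refl
  turn-periodic double j = cong turnAt ([m+n]%n≡m%n j P)

  trajectory-keep : ∀ j → trajectory keep P j ≡ toℤ₄ j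
  trajectory-keep zero = refl
  trajectory-keep (suc j) = trans (cong (_⊕ z1) (trajectory-keep j)) (sym (toℤ₄-suc j))

  trajectory-double-< : ∀ {j} → j < P → trajectory double P (suc j) ≡ toℤ₄ (suc j) ⊕ z2
  trajectory-double-< {zero} _ = cong turnAt (m<n⇒m%n≡m (>-nonZero⁻¹ P))
  trajectory-double-< {suc j} j<P = begin
    trajectory double P (suc j) ⊕ turnAt (suc j % P)  ≡⟨ cong ((trajectory double P (suc j) ⊕_) ∘ turnAt) (m<n⇒m%n≡m j<P) ⟩
    trajectory double P (suc j) ⊕ z1                  ≡⟨ cong (_⊕ z1) (trajectory-double-< (<⇒≤ j<P)) ⟩
    toℤ₄ (suc j) ⊕ z2 ⊕ z1                            ≡⟨ xy⊕z≡xz⊕y (toℤ₄ (suc j)) z2 z1 ⟩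
    toℤ₄ (suc j) ⊕ z1 ⊕ z2                            ≡⟨ cong (_⊕ z2) (toℤ₄-suc (suc j)) ⟨
    toℤ₄ (suc (suc j)) ⊕ z2                           ∎
    where open ≡-Reasoning

  -- The trajectory advances by P − 2 per period in the doubling case, hence by 2 when 4 ∣ P.
  trajectory-shift : toℤ₄ P ≡ z0 → ∀ k j → trajectory k P (j + P) ≡ trajectory k P j ⊕ offset k
  trajectory-shift 4∣P keep j = begin
    trajectory keep P (j + P)  ≡⟨ trajectory-keep (j + P) ⟩
    toℤ₄ (j + P)               ≡⟨ toℤ₄-+ j P ⟩
    toℤ₄ j ⊕ toℤ₄ P            ≡⟨ cong₂ _⊕_ (trajectory-keep j) (sym 4∣P) ⟨
    trajectory keep P j ⊕ z0   ∎
    where open ≡-Reasoning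
  trajectory-shift 4∣P double zero = begin
    trajectory double P P               ≡⟨ cong (trajectory double P) (suc-pred P) ⟨
    trajectory double P (suc (pred P))  ≡⟨ trajectory-double-< (≤-reflexive (suc-pred P)) ⟩
    toℤ₄ (suc (pred P)) ⊕ z2            ≡⟨ cong (λ n → toℤ₄ n ⊕ z2) (suc-pred P) ⟩
    toℤ₄ P ⊕ z2                         ≡⟨ cong (_⊕ z2) 4∣P ⟩
    z2                                  ∎
    where open ≡-Reasoning
  trajectory-shift 4∣P double (suc j) = begin
    trajectory double P (j + P) ⊕ turn double P (j + P)
      ≡⟨ cong₂ _⊕_ (trajectory-shift 4∣P double j) (turn-periodic double j) ⟩
    trajectory double P j ⊕ z2 ⊕ turn double P j
      ≡⟨ xy⊕z≡xz⊕y (trajectory double P j) z2 (turn double P j) ⟩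
    trajectory double P (suc j) ⊕ z2
      ∎
    where open ≡-Reasoning

data Halves (P : ℕ) : ℕ → Set where
  lower : ∀ {j} → j < P → Halves P j
  upper : ∀ {j} → j < P → Halves P (j + P)

halves : ∀ P {j} → j < P + P → Halves P j
halves P {j} j<2P with j <? P
... | yes j<P = lower j<P
... | no j≮P = subst (Halves P) j∸P+P≡j (upper (+-cancelʳ-< P (j ∸ P) P (subst (_< P + P) (sym j∸P+P≡j) j<2P)))
  where
  j∸P+P≡j : j ∸ P + P ≡ j
  j∸P+P≡j = m∸n+n≡m (≮⇒≥ j≮P)

module _ {P : ℕ} where

  base : ∀ {j} → Halves P j → ℕ
  base (lower {j} _) = j
  base (upper {j} _) = j

  base<P : ∀ {j} (h : Halves P j) → base h < P
  base<P (lower j<P) = j<P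
  base<P (upper j<P) = j<P

  lift : ∀ {j} → Halves P j → ℤ₄
  lift (lower _) = z0
  lift (upper _) = z2

  lift-even : ∀ {j} (h : Halves P j) → IsEven (lift h)
  lift-even (lower _) = inj₁ refl
  lift-even (upper _) = inj₂ refl

  halves-periodic : ∀ {A : Set} (f : ℕ → A) → (∀ j → f (j + P) ≡ f j) →
                    ∀ {j} (h : Halves P j) → f j ≡ f (base h)
  halves-periodic f periodic (lower _) = refl
  halves-periodic f periodic (upper {j} _) = periodic j

  halves-shift : ∀ (F : ℕ → ℤ₄) → (∀ j → F (j + P) ≡ F j ⊕ z2) →
                 ∀ {j} (h : Halves P j) → F j ≡ F (base h) ⊕ lift h
  halves-shift F shift (lower {j} _) = sym (⊕-identityʳ (F j))
  halves-shift F shift (upper {j} _) = shift j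

  halves-injective : ∀ {j j'} (h : Halves P j) (h' : Halves P j') → base h ≡ base h' → lift h ≡ lift h' → j ≡ j'
  halves-injective (lower _) (lower _) b≡b' _ = b≡b'
  halves-injective (upper _) (upper _) b≡b' _ = cong (_+ P) b≡b'
  halves-injective (lower _) (upper _) _ ()
  halves-injective (upper _) (lower _) _ ()

-- The period is written as a successor so that instance search finds NonZero (period ks).
period-1 : List Kind → ℕ
period-1 [] = 3
period-1 (keep ∷ ks) = period-1 ks
period-1 (double ∷ ks) = period-1 ks + suc (period-1 ks)

period : List Kind → ℕ
period ks = suc (period-1 ks)

4≤period : ∀ ks → 4 ≤ period ks
4≤period [] = ≤-refl
4≤period (keep ∷ ks) = 4≤period ks
4≤period (double ∷ ks) = ≤-trans (4≤period ks) (m≤m+n _ _)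

toℤ₄-period : ∀ ks → toℤ₄ (period ks) ≡ z0
toℤ₄-period [] = refl
toℤ₄-period (keep ∷ ks) = toℤ₄-period ks
toℤ₄-period (double ∷ ks) =
  trans (toℤ₄-+ (period ks) (period ks)) (cong₂ _⊕_ (toℤ₄-period ks) (toℤ₄-period ks))

period-∷-periodic : ∀ {A : Set} k ks (f : ℕ → A) → (∀ j → f (j + period ks) ≡ f j) →
                    ∀ j → f (j + period (k ∷ ks)) ≡ f j
period-∷-periodic keep ks f periodic j = periodic j
period-∷-periodic double ks f periodic j =
  trans (cong f (sym (+-assoc j (period ks) (period ks)))) (trans (periodic (j + period ks)) (periodic j))

period-∷-shift : ∀ k ks (F : ℕ → ℤ₄) → (∀ j → F (j + period ks) ≡ F j ⊕ offset k) →
                 ∀ j → F (j + period (k ∷ ks)) ≡ F j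
period-∷-shift keep ks F shift j = trans (shift j) (⊕-identityʳ (F j))
period-∷-shift double ks F shift j = begin
  F (j + (P + P))   ≡⟨ cong F (+-assoc j P P) ⟨
  F (j + P + P)     ≡⟨ shift (j + P) ⟩
  F (j + P) ⊕ z2    ≡⟨ cong (_⊕ z2) (shift j) ⟩
  F j ⊕ z2 ⊕ z2     ≡⟨ ⊕-assoc (F j) z2 z2 ⟩
  F j ⊕ z0          ≡⟨ ⊕-identityʳ (F j) ⟩
  F j               ∎
  where
  open ≡-Reasoning
  P : ℕ
  P = period ks

count : List Kind → ℕ
count [] = 1
count (k ∷ ks) = radix k * count ks

dim : List Kind → ℕ
dim ks = suc (length ks)

digit : ∀ {r} → Fin r → ℤ₄
digit a = toℤ₄ (toℕ a)

split : ∀ k ks → Fin (count (k ∷ ks)) → Fin (radix k) × Fin (count ks)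
split k ks = remQuot (count ks)

digitOf : ∀ k ks → Fin (count (k ∷ ks)) → ℤ₄
digitOf k ks i = digit (proj₁ (split k ks i))

restOf : ∀ k ks → Fin (count (k ∷ ks)) → Fin (count ks)
restOf k ks i = proj₂ (split k ks i)

leading : Kind → (P : ℕ) → .{{NonZero P}} → ℕ → ℕ → ℤ₄
leading k P j zero = trajectory k P j
leading k P j (suc _) = trajectory k P (suc j)

-- Cycle i in block j after q of its moves; in every block coordinate c moves at move c.
walk : ∀ ks → Fin (count ks) → ℕ → ℕ → Vec ℤ₄ (dim ks)
walk [] i j q = leading keep 4 j q ∷ []
walk (k ∷ ks) i j q =
  leading k (period ks) j q ⊕ digitOf k ks i ∷ walk ks (restOf k ks i) j (pred q)

sign : ∀ ks → Fin (dim ks) → ℕ → ℤ₄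
sign [] zero j = turn keep 4 j
sign (k ∷ ks) zero j = turn k (period ks) j
sign (k ∷ ks) (suc c) j = sign ks c j

sign-unit : ∀ ks c j → IsUnit (sign ks c j)
sign-unit [] zero j = inj₁ refl
sign-unit (k ∷ ks) zero j = turn-unit (period ks) k j
sign-unit (k ∷ ks) (suc c) j = sign-unit ks c j

sign-periodic : ∀ ks c j → sign ks c (j + period ks) ≡ sign ks c j
sign-periodic [] zero j = refl
sign-periodic (k ∷ ks) zero j = period-∷-periodic k ks (turn k (period ks)) (turn-periodic (period ks) k) j
sign-periodic (k ∷ ks) (suc c) j = period-∷-periodic k ks (sign ks c) (sign-periodic ks c) j

walk-step : ∀ ks i j (c : Fin (dim ks)) → walk ks i j (suc (toℕ c)) ≡ step c (sign ks c j) (walk ks i j (toℕ c))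
walk-step [] i j zero = refl
walk-step (k ∷ ks) i j zero =
  cong (_∷ walk ks (restOf k ks i) j 0) (xy⊕z≡xz⊕y (trajectory k (period ks) j) (turn k (period ks) j) (digitOf k ks i))
walk-step (k ∷ ks) i j (suc c) =
  cong (trajectory k (period ks) (suc j) ⊕ digitOf k ks i ∷_) (walk-step ks (restOf k ks i) j c)

walk-block : ∀ ks i j → walk ks i j (dim ks) ≡ walk ks i (suc j) 0
walk-block [] i j = refl
walk-block (k ∷ ks) i j = cong (trajectory k (period ks) (suc j) ⊕ digitOf k ks i ∷_) (walk-block ks (restOf k ks i) j)

leading-shift : ∀ P .{{_ : NonZero P}} → toℤ₄ P ≡ z0 →
                ∀ k j q → leading k P (j + P) q ≡ leading k P j q ⊕ offset k
leading-shift P 4∣P k j zero = trajectory-shift P 4∣P k j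
leading-shift P 4∣P k j (suc q) = trajectory-shift P 4∣P k (suc j)

walk-periodic : ∀ ks i j q → walk ks i (j + period ks) q ≡ walk ks i j q
walk-periodic [] i j q = cong (_∷ []) (trans (leading-shift 4 refl keep j q) (⊕-identityʳ _))
walk-periodic (k ∷ ks) i j q = cong₂ _∷_
  (cong (_⊕ digitOf k ks i) (period-∷-shift k ks (λ j → leading k (period ks) j q)
                                                 (λ j → leading-shift (period ks) (toℤ₄-period ks) k j q) j))
  (period-∷-periodic k ks (λ j → walk ks (restOf k ks i) j (pred q))
                          (λ j → walk-periodic ks (restOf k ks i) j (pred q)) j)

leading-injective : ∀ k P .{{_ : NonZero P}} j {q q' e e'} → IsEven e → IsEven e' → pred q ≡ pred q' →
                    leading k P j q ⊕ e ≡ leading k P j q' ⊕ e' → q ≡ q' × e ≡ e'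
leading-injective k P j {zero} {zero} _ _ _ eq = refl , ⊕-cancelˡ (trajectory k P j) _ _ eq
leading-injective k P j {suc q} {suc q'} _ _ pq eq = cong suc pq , ⊕-cancelˡ (trajectory k P (suc j)) _ _ eq
leading-injective k P j {zero} {suc q'} ev ev' _ eq = ⊥-elim (even≢unit⊕even (turn-unit P k j) ev ev'
  (⊕-cancelˡ (trajectory k P j) _ _ (trans eq (⊕-assoc (trajectory k P j) _ _))))
leading-injective k P j {suc q} {zero} ev ev' _ eq = ⊥-elim (even≢unit⊕even (turn-unit P k j) ev' ev
  (⊕-cancelˡ (trajectory k P j) _ _ (trans (sym eq) (⊕-assoc (trajectory k P j) _ _))))

pred-< : ∀ {q n} → q < suc (suc n) → pred q < suc n
pred-< q< = s≤s (pred-mono-≤ (s≤s⁻¹ q<))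

walk-injective : ∀ ks i {j j' q q'} → j < period ks → j' < period ks → q < dim ks → q' < dim ks →
                 walk ks i j q ≡ walk ks i j' q' → j ≡ j' × q ≡ q'
walk-injective [] i {j} {j'} {zero} {zero} j< j'< _ _ eq =
  toℤ₄-injective-<4 j< j'< (trans (sym (trajectory-keep 4 j)) (trans (∷-injectiveˡ eq) (trajectory-keep 4 j'))) , refl
walk-injective [] i {q = suc _} _ _ (s≤s ()) _ _
walk-injective [] i {q' = suc _} _ _ _ (s≤s ()) _
walk-injective (keep ∷ ks) i {j} {q = q} {q'} j< j'< q< q'< eq
  with walk-injective ks (restOf keep ks i) j< j'< (pred-< q<) (pred-< q'<) (∷-injectiveʳ eq)
... | refl , pq = refl , proj₁ (leading-injective keep (period ks) j (inj₁ refl) (inj₁ refl) pq (cong (_⊕ z0) lead-eq))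
  where
  lead-eq : leading keep (period ks) j q ≡ leading keep (period ks) j q'
  lead-eq = ⊕-cancelʳ (digitOf keep ks i) _ _ (∷-injectiveˡ eq)
walk-injective (double ∷ ks) i {j} {j'} {q} {q'} j< j'< q< q'< eq =
  halves-injective h h' (proj₁ rest-eq) (proj₂ lead-eq) , proj₁ lead-eq
  where
  P : ℕ
  P = period ks
  i' : Fin (count ks)
  i' = restOf double ks i
  h : Halves P j
  h = halves P j<
  h' : Halves P j'
  h' = halves P j'<

  rest-periodic : ∀ r j → walk ks i' (j + P) r ≡ walk ks i' j r
  rest-periodic r j = walk-periodic ks i' j r

  lead-shift : ∀ r j → leading double P (j + P) r ≡ leading double P j r ⊕ z2
  lead-shift r j = leading-shift P (toℤ₄-period ks) double j r

  rest-eq : base h ≡ base h' × pred q ≡ pred q'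
  rest-eq = walk-injective ks i' (base<P h) (base<P h') (pred-< q<) (pred-< q'<)
    (trans (sym (halves-periodic (λ j → walk ks i' j (pred q)) (rest-periodic (pred q)) h))
    (trans (∷-injectiveʳ eq)
           (halves-periodic (λ j → walk ks i' j (pred q')) (rest-periodic (pred q')) h')))

  lead-eq : q ≡ q' × lift h ≡ lift h'
  lead-eq = leading-injective double P (base h) (lift-even h) (lift-even h') (proj₂ rest-eq)
    (trans (sym (halves-shift (λ j → leading double P j q) (lead-shift q) h))
    (trans (⊕-cancelʳ (digitOf double ks i) (leading double P j q) (leading double P j' q') (∷-injectiveˡ eq))
    (trans (halves-shift (λ j → leading double P j q') (lead-shift q') h')
           (cong (λ b → leading double P b q' ⊕ lift h') (sym (proj₁ rest-eq))))))

radix≤4 : ∀ k → radix k ≤ 4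
radix≤4 keep = ≤-refl
radix≤4 double = s≤s (s≤s z≤n)

digit-injective : ∀ {r} → r ≤ 4 → {a a' : Fin r} → digit a ≡ digit a' → a ≡ a'
digit-injective r≤4 {a} {a'} e =
  toℕ-injective (toℤ₄-injective-<4 (≤-trans (toℕ<n a) r≤4) (≤-trans (toℕ<n a') r≤4) e)

digit-surjective : ∀ z → Σ (Fin 4) λ a → digit a ≡ z
digit-surjective z = fromℕ< (toℕ₄<4 z) , trans (cong toℤ₄ (toℕ-fromℕ< (toℕ₄<4 z))) (toℤ₄-toℕ₄ z)

even⊕digit-surjective : ∀ z → Σ (Fin 2) λ a → Σ ℤ₄ λ e → IsEven e × e ⊕ digit a ≡ z
even⊕digit-surjective z0 = zero , z0 , inj₁ refl , refl
even⊕digit-surjective z1 = suc zero , z0 , inj₁ refl , refl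
even⊕digit-surjective z2 = zero , z2 , inj₂ refl , refl
even⊕digit-surjective z3 = suc zero , z2 , inj₂ refl , refl

even⊕digit-injective : ∀ {e e'} {a a' : Fin 2} → IsEven e → IsEven e' →
                       e ⊕ digit a ≡ e' ⊕ digit a' → e ≡ e' × a ≡ a'
even⊕digit-injective {a = zero} {zero} _ _ eq = ⊕-cancelʳ z0 _ _ eq , refl
even⊕digit-injective {a = suc zero} {suc zero} _ _ eq = ⊕-cancelʳ z1 _ _ eq , refl
even⊕digit-injective {e} {e'} {zero} {suc zero} ev ev' eq =
  ⊥-elim (even≢unit⊕even (inj₁ refl) ev ev' (trans (sym (⊕-identityʳ e)) (trans eq (⊕-comm e' z1))))
even⊕digit-injective {e} {e'} {suc zero} {zero} ev ev' eq =
  ⊥-elim (even≢unit⊕even (inj₁ refl) ev' ev (trans (sym (⊕-identityʳ e')) (trans (sym eq) (⊕-comm e z1))))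

digitOf-combine : ∀ k ks (a : Fin (radix k)) i → digitOf k ks (combine a i) ≡ digit a × restOf k ks (combine a i) ≡ i
digitOf-combine k ks a i = cong (digit ∘ proj₁) (remQuot-combine a i) , cong proj₂ (remQuot-combine a i)

digitOf-injective : ∀ k ks {i i'} → digitOf k ks i ≡ digitOf k ks i' → restOf k ks i ≡ restOf k ks i' → i ≡ i'
digitOf-injective k ks {i} {i'} d≡ r≡ = begin
  i                                ≡⟨ combine-remQuot {radix k} (count ks) i ⟨
  uncurry combine (split k ks i)   ≡⟨ cong₂ combine (digit-injective (radix≤4 k) d≡) r≡ ⟩
  uncurry combine (split k ks i')  ≡⟨ combine-remQuot {radix k} (count ks) i' ⟩
  i'                               ∎
  where open ≡-Reasoning

record PeriodicBijection {t} (N P : ℕ) (h : Fin N → ℕ → Vec ℤ₄ t) : Set where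
  field
    surjective : ∀ x → Σ (Fin N) λ i → Σ ℕ λ j → j < P × h i j ≡ x
    injective  : ∀ {i i' j j'} → j < P → j' < P → h i j ≡ h i' j' → i ≡ i' × j ≡ j'
    periodic   : ∀ i j → h i (j + P) ≡ h i j

open PeriodicBijection

PeriodicBijection-cong : ∀ {t N P} {h h' : Fin N → ℕ → Vec ℤ₄ t} → (∀ i j → h i j ≡ h' i j) →
                         PeriodicBijection N P h → PeriodicBijection N P h'
PeriodicBijection-cong h≗h' b = record
  { surjective = λ x → let (i , j , j< , e) = surjective b x in i , j , j< , trans (sym (h≗h' i j)) e
  ; injective = λ j< j'< e → injective b j< j'< (trans (h≗h' _ _) (trans e (sym (h≗h' _ _))))
  ; periodic = λ i j → trans (sym (h≗h' i (j + _))) (trans (periodic b i j) (h≗h' i j))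
  }

extend : ∀ k ks {t} → (ℕ → ℤ₄) → (Fin (count ks) → ℕ → Vec ℤ₄ t) →
         Fin (count (k ∷ ks)) → ℕ → Vec ℤ₄ (suc t)
extend k ks F h i j = F j ⊕ digitOf k ks i ∷ h (restOf k ks i) j

lands-on : ∀ x x' e d y → x' ≡ x ⊕ e → e ⊕ d ≡ - x ⊕ y → x' ⊕ d ≡ y
lands-on x x' e d y x'≡ e⊕d≡ = begin
  x' ⊕ d         ≡⟨ cong (_⊕ d) x'≡ ⟩
  x ⊕ e ⊕ d      ≡⟨ ⊕-assoc x e d ⟩
  x ⊕ (e ⊕ d)    ≡⟨ cong (x ⊕_) e⊕d≡ ⟩
  x ⊕ (- x ⊕ y)  ≡⟨ ⊕-[-⊕] x y ⟩
  y              ∎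
  where open ≡-Reasoning

lands-on-same : ∀ x {d y} → d ≡ - x ⊕ y → x ⊕ d ≡ y
lands-on-same x {d} {y} d≡ = lands-on x x z0 d y (sym (⊕-identityʳ x)) d≡

module _ ks {t} {F : ℕ → ℤ₄} {h : Fin (count ks) → ℕ → Vec ℤ₄ t}
         (b : PeriodicBijection (count ks) (period ks) h) where

  private
    P : ℕ
    P = period ks

    extend-combine : ∀ k (a : Fin (radix k)) i j → extend k ks F h (combine a i) j ≡ F j ⊕ digit a ∷ h i j
    extend-combine k a i j with digitOf-combine k ks a i
    ... | d≡ , r≡ = cong₂ (λ d r → F j ⊕ d ∷ h r j) d≡ r≡

  extend-surjective : ∀ k → (∀ j → F (j + P) ≡ F j ⊕ offset k) →
    ∀ x → Σ (Fin (count (k ∷ ks))) λ i → Σ ℕ λ j → j < period (k ∷ ks) × extend k ks F h i j ≡ x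
  extend-surjective keep _ (y ∷ x) with surjective b x
  ... | i , j , j< , hij≡x with digit-surjective (- F j ⊕ y)
  ...   | a , da = combine a i , j , j< ,
          trans (extend-combine keep a i j) (cong₂ _∷_ (lands-on-same (F j) da) hij≡x)
  extend-surjective double shift (y ∷ x) with surjective b x
  ... | i , j , j< , hij≡x with even⊕digit-surjective (- F j ⊕ y)
  ...   | a , .z0 , inj₁ refl , da = combine a i , j , ≤-trans j< (m≤m+n P P) ,
          trans (extend-combine double a i j) (cong₂ _∷_ (lands-on-same (F j) da) hij≡x)
  ...   | a , .z2 , inj₂ refl , da = combine a i , j + P , +-monoˡ-< P j< ,
          trans (extend-combine double a i (j + P))
                (cong₂ _∷_ (lands-on (F j) (F (j + P)) z2 (digit a) y (shift j) da) (trans (periodic b i j) hij≡x))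

  extend-injective : ∀ k → (∀ j → F (j + P) ≡ F j ⊕ offset k) → ∀ {i i' j j'} →
    j < period (k ∷ ks) → j' < period (k ∷ ks) → extend k ks F h i j ≡ extend k ks F h i' j' → i ≡ i' × j ≡ j'
  extend-injective keep _ {i} {i'} {j} j< j'< e with injective b j< j'< (∷-injectiveʳ e)
  ... | r≡ , refl = digitOf-injective keep ks (⊕-cancelˡ (F j) _ _ (∷-injectiveˡ e)) r≡ , refl
  extend-injective double shift {i} {i'} {j} {j'} j< j'< e =
    digitOf-injective double ks (cong digit (proj₂ head-eq)) (proj₁ rest-eq) ,
    halves-injective hv hv' (proj₂ rest-eq) (proj₁ head-eq)
    where
    hv : Halves P j
    hv = halves P j<
    hv' : Halves P j'
    hv' = halves P j'<
    d : ℤ₄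
    d = digitOf double ks i
    d' : ℤ₄
    d' = digitOf double ks i'

    rest-eq : restOf double ks i ≡ restOf double ks i' × base hv ≡ base hv'
    rest-eq = injective b (base<P hv) (base<P hv')
      (trans (sym (halves-periodic (h (restOf double ks i)) (periodic b _) hv))
      (trans (∷-injectiveʳ e) (halves-periodic (h (restOf double ks i')) (periodic b _) hv')))

    head-eq : lift hv ≡ lift hv' × proj₁ (split double ks i) ≡ proj₁ (split double ks i')
    head-eq = even⊕digit-injective (lift-even hv) (lift-even hv') (⊕-cancelˡ (F (base hv)) _ _ (begin
      F (base hv) ⊕ (lift hv ⊕ d)     ≡⟨ ⊕-assoc (F (base hv)) (lift hv) d ⟨
      F (base hv) ⊕ lift hv ⊕ d       ≡⟨ cong (_⊕ d) (halves-shift F shift hv) ⟨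
      F j ⊕ d                         ≡⟨ ∷-injectiveˡ e ⟩
      F j' ⊕ d'                       ≡⟨ cong (_⊕ d') (halves-shift F shift hv') ⟩
      F (base hv') ⊕ lift hv' ⊕ d'    ≡⟨ cong (λ r → F r ⊕ lift hv' ⊕ d') (proj₂ rest-eq) ⟨
      F (base hv) ⊕ lift hv' ⊕ d'     ≡⟨ ⊕-assoc (F (base hv)) (lift hv') d' ⟩
      F (base hv) ⊕ (lift hv' ⊕ d')   ∎))
      where open ≡-Reasoning

  extend-bijection : ∀ k → (∀ j → F (j + P) ≡ F j ⊕ offset k) →
                     PeriodicBijection (count (k ∷ ks)) (period (k ∷ ks)) (extend k ks F h)
  extend-bijection k shift = record
    { surjective = extend-surjective k shift
    ; injective = extend-injective k shift
    ; periodic = λ i j → cong₂ _∷_ (cong (_⊕ digitOf k ks i) (period-∷-shift k ks F shift j))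
                                   (period-∷-periodic k ks (h (restOf k ks i)) (periodic b (restOf k ks i)) j)
    }

edgeAt : ∀ ks → Fin (count ks) → ℕ → Fin (dim ks) → Vec ℤ₄ (dim ks)
edgeAt ks i j c = lowerEnd (sign ks c j) (walk ks i j (toℕ c)) (walk ks i j (suc (toℕ c)))

starts : ∀ ks → PeriodicBijection (count ks) (period ks) (λ i j → walk ks i j 0)
starts [] = record
  { surjective = λ { (x ∷ []) → zero , toℕ₄ x , toℕ₄<4 x ,
                                  cong (_∷ []) (trans (trajectory-keep 4 (toℕ₄ x)) (toℤ₄-toℕ₄ x)) }
  ; injective = λ { {zero} {zero} j< j'< e → refl , proj₁ (walk-injective [] zero j< j'< (s≤s z≤n) (s≤s z≤n) e) }
  ; periodic = λ i j → walk-periodic [] i j 0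
  }
starts (k ∷ ks) =
  extend-bijection ks {F = trajectory k (period ks)} (starts ks) k (trajectory-shift (period ks) (toℤ₄-period ks) k)

tile : ∀ ks c → PeriodicBijection (count ks) (period ks) (λ i j → edgeAt ks i j c)
tile [] zero = starts []
tile (k ∷ ks) zero = PeriodicBijection-cong extend≗edgeAt (extend-bijection ks {F = F} (starts ks) k F-shift)
  where
  P : ℕ
  P = period ks
  F : ℕ → ℤ₄
  F j = lowerEnd (turn k P j) (trajectory k P j) (trajectory k P (suc j))

  4∣P : toℤ₄ P ≡ z0
  4∣P = toℤ₄-period ks

  F-shift : ∀ j → F (j + P) ≡ F j ⊕ offset k
  F-shift j = begin
    lowerEnd (turn k P (j + P)) (trajectory k P (j + P)) (trajectory k P (suc j + P))
      ≡⟨ cong₂ (λ s (ab : ℤ₄ × ℤ₄) → lowerEnd s (proj₁ ab) (proj₂ ab)) (turn-periodic P k j)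
               (cong₂ _,_ (trajectory-shift P 4∣P k j) (trajectory-shift P 4∣P k (suc j))) ⟩
    lowerEnd (turn k P j) (trajectory k P j ⊕ offset k) (trajectory k P (suc j) ⊕ offset k)
      ≡⟨ if-float (_⊕ offset k) (forward (turn k P j)) ⟨
    F j ⊕ offset k ∎
    where open ≡-Reasoning

  extend≗edgeAt : ∀ i j → extend k ks F (λ i j → walk ks i j 0) i j ≡ edgeAt (k ∷ ks) i j zero
  extend≗edgeAt i j = sym (trans (lowerEnd-∷ (turn k P j) _ _ _ _)
    (cong₂ _∷_ (sym (if-float (_⊕ digitOf k ks i) (forward (turn k P j)))) (if-eta (forward (turn k P j)))))
tile (k ∷ ks) (suc c) =
  PeriodicBijection-cong extend≗edgeAt
    (extend-bijection ks {F = F} (tile ks c) k (λ j → trajectory-shift P (toℤ₄-period ks) k (suc j)))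
  where
  P : ℕ
  P = period ks
  F : ℕ → ℤ₄
  F j = trajectory k P (suc j)

  extend≗edgeAt : ∀ i j → extend k ks F (λ i j → edgeAt ks i j c) i j ≡ edgeAt (k ∷ ks) i j (suc c)
  extend≗edgeAt i j = sym (trans (lowerEnd-∷ (sign ks c j) _ _ _ _)
    (cong (_∷ edgeAt ks (restOf k ks i) j c) (if-eta (forward (sign ks c j)))))

move-joins : ∀ ks i j c → Joins (edgeAt ks i j c) (step c z1 (edgeAt ks i j c))
                                (walk ks i j (toℕ c) , walk ks i j (suc (toℕ c)))
move-joins ks i j c with sign ks c j | sign-unit ks c j | walk-step ks i j c
... | .z1 | inj₁ refl | next = inj₁ (refl , next)
... | .z3 | inj₂ refl | next = inj₂ (trans (sym (step-inverse c _)) (cong (step c z1) (sym next)) , refl)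

position-%/ : ∀ {t} .{{_ : NonZero t}} j {c} → c < t → (c + j * t) % t ≡ c × (c + j * t) / t ≡ j
position-%/ {t} j {c} c<t = trans ([m+kn]%n≡m%n c j t) (m<n⇒m%n≡m c<t) , (begin
  (c + j * t) / t      ≡⟨ +-distrib-/-∣ʳ c (n∣m*n j) ⟩
  c / t + j * t / t    ≡⟨ cong₂ _+_ (m<n⇒m/n≡0 c<t) (m*n/n≡m j t) ⟩
  j                    ∎)
  where open ≡-Reasoning

module Staircase (ks : List Kind) where

  t : ℕ
  t = dim ks

  L : ℕ
  L = period ks * t

  walkAt : Fin (count ks) → ℕ → Vec ℤ₄ t
  walkAt i p = walk ks i (p / t) (p % t)

  direction : ℕ → Fin t
  direction p = fromℕ< (m%n<n p t)

  toℕ-direction : ∀ p → toℕ (direction p) ≡ p % t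
  toℕ-direction p = toℕ-fromℕ< (m%n<n p t)

  walkAt-position : ∀ i j {q} → q < t → walkAt i (q + j * t) ≡ walk ks i j q
  walkAt-position i j q<t with position-%/ j q<t
  ... | %≡ , /≡ = cong₂ (walk ks i) /≡ %≡

  walkAt-next : ∀ i p → walkAt i (suc p) ≡ walk ks i (p / t) (suc (p % t))
  walkAt-next i p with m≤n⇒m<n∨m≡n (m%n<n p t)
  ... | inj₁ 1+r<t = begin
    walkAt i (suc p)                    ≡⟨ cong (walkAt i ∘ suc) (m≡m%n+[m/n]*n p t) ⟩
    walkAt i (suc (p % t) + p / t * t)  ≡⟨ walkAt-position i (p / t) 1+r<t ⟩
    walk ks i (p / t) (suc (p % t))     ∎
    where open ≡-Reasoning
  ... | inj₂ 1+r≡t = begin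
    walkAt i (suc p)                    ≡⟨ cong (walkAt i ∘ suc) (m≡m%n+[m/n]*n p t) ⟩
    walkAt i (suc (p % t) + p / t * t)  ≡⟨ cong (λ r → walkAt i (r + p / t * t)) 1+r≡t ⟩
    walkAt i (0 + suc (p / t) * t)      ≡⟨ walkAt-position i (suc (p / t)) (s≤s z≤n) ⟩
    walk ks i (suc (p / t)) 0           ≡⟨ walk-block ks i (p / t) ⟨
    walk ks i (p / t) t                 ≡⟨ cong (walk ks i (p / t)) 1+r≡t ⟨
    walk ks i (p / t) (suc (p % t))     ∎
    where open ≡-Reasoning

  walkAt-suc : ∀ i p → walkAt i (suc p) ≡ step (direction p) (sign ks (direction p) (p / t)) (walkAt i p)
  walkAt-suc i p = begin
    walkAt i (suc p)                           ≡⟨ walkAt-next i p ⟩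
    walk ks i (p / t) (suc (p % t))            ≡⟨ cong (walk ks i (p / t) ∘ suc) (toℕ-direction p) ⟨
    walk ks i (p / t) (suc (toℕ c))            ≡⟨ walk-step ks i (p / t) c ⟩
    step c s (walk ks i (p / t) (toℕ c))       ≡⟨ cong (step c s ∘ walk ks i (p / t)) (toℕ-direction p) ⟩
    step c s (walkAt i p)                      ∎
    where
    open ≡-Reasoning
    c : Fin t
    c = direction p
    s : ℤ₄
    s = sign ks c (p / t)

  walkAt-edgeAt : ∀ i p → lowerEnd (sign ks (direction p) (p / t)) (walkAt i p) (walkAt i (suc p)) ≡
                          edgeAt ks i (p / t) (direction p)
  walkAt-edgeAt i p = cong₂ (lowerEnd (sign ks (direction p) (p / t)))
    (cong (walk ks i (p / t)) (sym (toℕ-direction p)))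
    (trans (walkAt-next i p) (cong (walk ks i (p / t) ∘ suc) (sym (toℕ-direction p))))

  walkAt-closes : ∀ i → walkAt i L ≡ walkAt i 0
  walkAt-closes i = trans (walkAt-position i (period ks) (s≤s z≤n)) (walk-periodic ks i 0 0)

  p<L⇒p/t<period : ∀ {p} → p < L → p / t < period ks
  p<L⇒p/t<period = m<n*o⇒m/o<n

  walkAt-injective : ∀ i {p p'} → p < L → p' < L → walkAt i p ≡ walkAt i p' → p ≡ p'
  walkAt-injective i {p} {p'} p<L p'<L e
    with walk-injective ks i (p<L⇒p/t<period p<L) (p<L⇒p/t<period p'<L) (m%n<n p t) (m%n<n p' t) e
  ... | /≡ , %≡ = begin
    p                    ≡⟨ m≡m%n+[m/n]*n p t ⟩
    p % t + p / t * t    ≡⟨ cong₂ (λ r q → r + q * t) %≡ /≡ ⟩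
    p' % t + p' / t * t  ≡⟨ m≡m%n+[m/n]*n p' t ⟨
    p'                   ∎
    where open ≡-Reasoning

  vertex : Fin (count ks) → ℕ → Vertex (t * 2)
  vertex i p = gray (walkAt i p)

  3≤L : 3 ≤ L
  3≤L = ≤-trans (≤-trans (s≤s (s≤s (s≤s z≤n))) (4≤period ks)) (m≤m*n (period ks) t)

  vertex-closes : ∀ i → vertex i L ≡ vertex i 0
  vertex-closes i = cong gray (walkAt-closes i)

  cycle : Fin (count ks) → Cycle (t * 2) L
  cycle i = closedWalk (vertex i) 3≤L (vertex-closes i)
    (λ p<p' p'<L e → <⇒≢ p<p' (walkAt-injective i (<-trans p<p' p'<L) p'<L (gray-injective e)))
    (λ p → subst (Adj (vertex i p) ∘ gray) (sym (walkAt-suc i p))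
                 (gray-step-adjacent (direction p) (walkAt i p) (sign-unit ks (direction p) (p / t))))

  edge-in-cycle : ∀ {u v} c w i j → TorusEdge u v c w → j < period ks → edgeAt ks i j c ≡ w → EdgeOf u v (cycle i)
  edge-in-cycle {u} {v} c w i j uv j< edge≡w =
    edge-closedWalk⁺ (vertex i) 3≤L (vertex-closes i) p<L
      (subst (Joins u v) (sym vertices-p) (Joins-∘ uv (Joins-map gray move)))
    where
    p : ℕ
    p = toℕ c + j * t
    p<L : p < L
    p<L = ≤-trans (+-monoˡ-< (j * t) (toℕ<n c)) (*-monoˡ-≤ t j<)
    move : Joins w (step c z1 w) (walk ks i j (toℕ c) , walk ks i j (suc (toℕ c)))
    move = subst (λ w' → Joins w' (step c z1 w') _) edge≡w (move-joins ks i j c)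
    vertices-p : (vertex i p , vertex i (suc p)) ≡ (gray (walk ks i j (toℕ c)) , gray (walk ks i j (suc (toℕ c))))
    vertices-p with position-%/ j (toℕ<n c)
    ... | %≡ , /≡ = cong₂ _,_ (cong gray (walkAt-position i j (toℕ<n c)))
                              (cong gray (trans (walkAt-next i p) (cong₂ (λ a b → walk ks i a (suc b)) /≡ %≡)))

  edge-only-in-cycle : ∀ {u v} c w i → TorusEdge u v c w → EdgeOf u v (cycle i) →
                       Σ ℕ λ j → j < period ks × edgeAt ks i j c ≡ w
  edge-only-in-cycle {u} {v} c w i uv e with edge-closedWalk⁻ (vertex i) 3≤L (vertex-closes i) e
  ... | p , p<L , uv-at-p = p / t , p<L⇒p/t<period p<L , edgeAt≡w
    where
    c' : Fin t
    c' = direction p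
    s : ℤ₄
    s = sign ks c' (p / t)
    on-edge : c' ≡ c × lowerEnd s (walkAt i p) (step c' s (walkAt i p)) ≡ w
    on-edge = move-on-edge (sign-unit ks c' (p / t))
      (Joins-gray⁻ (Joins-∘ (Joins-sym uv) (subst (λ y → Joins u v (vertex i p , gray y)) (walkAt-suc i p) uv-at-p)))
    edgeAt≡w : edgeAt ks i (p / t) c ≡ w
    edgeAt≡w = subst (λ d → edgeAt ks i (p / t) d ≡ w) (proj₁ on-edge)
      (trans (sym (walkAt-edgeAt i p)) (trans (cong (lowerEnd s (walkAt i p)) (walkAt-suc i p)) (proj₂ on-edge)))

  staircase-decomposition : Decomposition (t * 2) L
  staircase-decomposition = decomposition cycle λ u v a →
    let (c , w , uv) = adjacent⇒torusEdge t a
        (i , j , j< , edge≡w) = surjective (tile ks c) w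
    in i , edge-in-cycle c w i j uv j< edge≡w ,
       λ i' e' → let (j' , j'< , edge'≡w) = edge-only-in-cycle c w i' uv e'
                 in proj₁ (injective (tile ks c) j'< j< (trans edge'≡w (sym edge≡w)))

period-keeps : ∀ a ks → period (replicate a keep ++ ks) ≡ period ks
period-keeps zero ks = refl
period-keeps (suc a) ks = period-keeps a ks

period-doubles : ∀ r → period (replicate r double) ≡ 2 ^ r * 4
period-doubles zero = refl
period-doubles (suc r) = trans (cong₂ _+_ (period-doubles r) (period-doubles r)) (double-eq (2 ^ r))
  where
  double-eq : ∀ x → x * 4 + x * 4 ≡ 2 * x * 4
  double-eq = solve-∀

n<2^n : ∀ n → n < 2 ^ n
n<2^n zero = s≤s z≤n
n<2^n (suc n) = +-mono-≤ (≤-trans (s≤s z≤n) (n<2^n n)) (≤-trans (n<2^n n) (m≤m+n (2 ^ n) 0))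

corollary1p2 : (n m r : ℕ) → 2 ≤ n → 2 ∣ n →
    2 ^ m ≤ n → n < 2 ^ suc m →
    1 ≤ r → r ≤ m →
    Decomposition n (2 ^ r * n)
corollary1p2 n m zero _ _ _ _ () _
corollary1p2 .0 m (suc r) () (divides zero refl) _ _ _ _
-- Only 2 ^ (r + 1) ≤ n is used: it leaves room for r doubling coordinates among the n / 2 − 1.
corollary1p2 .(suc s * 2) m (suc r) _ (divides (suc s) refl) 2^m≤n _ _ r<m =
  subst₂ Decomposition (cong (_* 2) dim≡) length≡ (Staircase.staircase-decomposition ks)
  where
  ks : List Kind
  ks = replicate (s ∸ r) keep ++ replicate r double

  r≤s : r ≤ s
  r≤s = s≤s⁻¹ (≤-trans (n<2^n r) (*-cancelʳ-≤ (2 ^ r) (suc s) 2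
          (≤-trans (≤-reflexive (*-comm (2 ^ r) 2)) (≤-trans (^-monoʳ-≤ 2 r<m) 2^m≤n))))

  dim≡ : dim ks ≡ suc s
  dim≡ = cong suc (trans (length-++ (replicate (s ∸ r) keep))
                  (trans (cong₂ _+_ (length-replicate (s ∸ r)) (length-replicate r)) (m∸n+n≡m r≤s)))

  length≡ : period ks * dim ks ≡ 2 ^ suc r * (suc s * 2)
  length≡ = trans (cong₂ _*_ (trans (period-keeps (s ∸ r) (replicate r double)) (period-doubles r)) dim≡)
                  (length-eq (2 ^ r) (suc s))
    where
    length-eq : ∀ x q → x * 4 * q ≡ 2 * x * (q * 2)
    length-eq = solve-∀
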